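{- Let $\mathcal{C}$ and $T_C$ be as in the context, and write an element of $\mathcal{C}$ as $[\lozenge,q_m]=[q_0,\dots,q_{m-1},q_m]$. (a) The $LR$-location of $[\lozenge,q_m]$ in $T_C$ (the string of left/right moves along the path from the root $[1]$ to it) is $f([\lozenge,q_m])=S(q_0,\dots,q_{m-1},q_m-1)$. (b) If $q_0,\dots,q_{m-1}$ are fixed, then the value of $[\lozenge,q_m]\in\mathcal{C}$ is an increasing function of $q_m$ if $m$ is even, and a decreasing function of $q_m$ if $m$ is odd. (c) The map $f:\mathcal{C}\to\{L,R\}^*$ is a bijection that preserves level (the level of $v$ in $T_C$ equals $|f(v)|$), preserves children ($f(C_L(v))=f(v)L$ and $f(C_R(v))=f(v)R$ for all $v\in\mathcal{C}$), and preserves order ($v<v'$ as rational numbers if and only if $r(f(v))<r(f(v'))$). (d) For $v=[\lozenge,q_m]\in\mathcal{C}$, its left parent $f^{ -1}(P_L(f(v)))$ is the largest, and its right parent $f^{ -1}(P_R(f(v)))$ is the smallest, among the elements $w\in\mathcal{C}\cup\{[0],[\ ]\}$ of level strictly less than the level of $v$ satisfying $w<v$, resp. $w>v$.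
   Context: A continued fraction $[q_0,\dots,q_m]$ denotes $q_0+1/(q_1+1/(\cdots+1/q_m))$, evaluated by $[q_0]=q_0$ and $[q_0,\dots,q_{m-1},q_m]=[q_0,\dots,q_{m-2},q_{m-1}+1/q_m]$ for $m>0$. $T_C$ is the infinite complete binary tree with root $[1]$ whose children are given by: for a vertex $[q_0,\dots,q_{m-1},q_m]$ with $m$ even, the left child is $[q_0,\dots,q_{m-1},q_m-1,2]$ and the right child is $[q_0,\dots,q_{m-1},q_m+1]$; with $m$ odd, the left child is $[q_0,\dots,q_{m-1},q_m+1]$ and the right child is $[q_0,\dots,q_{m-1},q_m-1,2]$. $\mathcal{C}$ is the set of vertices of $T_C$; each has $q_0\geq0$, $q_1,\dots,q_{m-1}\geq1$, and $q_m\geq2$ if $m>0$, and evaluates to a positive rational, giving the natural order on $\mathcal{C}$. $C_L(v)$, $C_R(v)$ are the left and right children of $v$ in $T_C$. The level of a vertex is its distance from the root, and equals $q_0+\cdots+q_m-1$. $\{L,R\}^*$ is the free monoid of strings in $L,R$; for $k_0\in\mathbb{N}$ and $k_1,\dots,k_m\geq1$, $S(k_0,\dots,k_m)=R^{k_0}L^{k_1}R^{k_2}\cdots$ with $m+1$ alternating blocks (last block $R^{k_m}$ if $m$ even, $L^{k_m}$ if $m$ odd), where a last exponent $0$ means that block is empty and $S(-1)$ means the generalized string $R^{ -1}$. The map $f$ is $f([q_0,\dots,q_{m-1},q_m])=S(q_0,\dots,q_{m-1},q_m-1)$; it is extended by $f([0])=R^{ -1}$ and $f([\ ])=L^{ -1}$,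 where $[0]=0$ and $[\ ]=1/0=\infty$ are regarded as elements of level $-1$. $|S|$ is the number of symbols in a string $S$. Right multiplication by $L^{ -1}$, $R^{ -1}$ is evaluated by $LL^{ -1}=\varepsilon$, $RR^{ -1}=\varepsilon$, $LR^{ -1}=R^{ -1}$, $RL^{ -1}=L^{ -1}$ ($\varepsilon$ the empty string), and $P_L(S)=SR^{ -1}$, $P_R(S)=SL^{ -1}$. The function $r$ is defined by $r(\varepsilon)=1$, $r(SL)=r(S)-2^{ -|SL|}$, $r(SR)=r(S)+2^{ -|SR|}$. -}

module Defs where

open import Data.Nat as ℕ using (ℕ; zero; suc; _∸_)
open import Data.Integer using (+_)
open import Data.Rational as ℚ using (ℚ; 0ℚ; 1ℚ; ½; 1/_; ≢-nonZero)
open import Data.Rational.Properties using (_≟_)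
open import Data.List using (List; []; _∷_; _++_; reverse; replicate; length)
open import Data.Bool using (Bool; true; false; not; if_then_else_)
open import Data.Unit using (⊤)
open import Data.Empty using (⊥)
open import Data.Product using (Σ; _×_; _,_)
open import Data.Sum using (_⊎_)
open import Relation.Nullary using (yes; no)
open import Relation.Binary.PropositionalEquality using (_≡_)

-- Continued fractions [q₀,…,qₘ] are lists of naturals.
-- The empty list [] is the symbol [ ] = 1/0 = ∞, and 0 ∷ [] is [0] = 0.

CF : Set
CF = List ℕ

data ℚ∞ : Set where
  fin : ℚ → ℚ∞
  ∞   : ℚ∞

_+1/_ : ℚ → ℚ∞ → ℚ∞
q +1/ ∞ = fin q
q +1/ fin x with x ≟ 0ℚ
... | yes _  = ∞
... | no x≢0 = fin (q ℚ.+ (1/ x) {{≢-nonZero x≢0}})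

eval : CF → ℚ∞
eval []       = ∞
eval (q ∷ qs) = (+ q ℚ./ 1) +1/ eval qs

_<∞_ : ℚ∞ → ℚ∞ → Set
fin a <∞ fin b = a ℚ.< b
fin _ <∞ ∞     = ⊤
∞     <∞ _     = ⊥

_≤∞_ : ℚ∞ → ℚ∞ → Set
fin a ≤∞ fin b = a ℚ.≤ b
_     ≤∞ ∞     = ⊤
∞     ≤∞ fin _ = ⊥

-- Strings in {L,R}*, written left to right (first move first).

data Dir : Set where
  L R : Dir

Str : Set
Str = List Dir

data GStr : Set where
  str  : Str → GStr
  Linv : GStr
  Rinv : GStr

-- The tree T_C.  'isEven' records whether the index of the head entry
-- is even; the rule is applied at the last entry qₘ.

childL′ childR′ : Bool → CF → CF
childL′ e []            = []
childL′ e (q ∷ [])      = if e then (q ∸ 1 ∷ 2 ∷ []) else (suc q ∷ [])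
childL′ e (q ∷ q′ ∷ qs) = q ∷ childL′ (not e) (q′ ∷ qs)
childR′ e []            = []
childR′ e (q ∷ [])      = if e then (suc q ∷ []) else (q ∸ 1 ∷ 2 ∷ [])
childR′ e (q ∷ q′ ∷ qs) = q ∷ childR′ (not e) (q′ ∷ qs)

CL CR : CF → CF
CL = childL′ true
CR = childR′ true

root : CF
root = 1 ∷ []

walk : CF → Str → CF
walk v []       = v
walk v (L ∷ ds) = walk (CL v) ds
walk v (R ∷ ds) = walk (CR v) ds

label : Str → CF
label = walk root

InC : CF → Set
InC v = Σ Str λ p → label p ≡ v

InExt : CF → Set
InExt w = InC w ⊎ (w ≡ 0 ∷ [] ⊎ w ≡ [])

S′ : Dir → List ℕ → Str
S′ d []       = []
S′ L (k ∷ ks) = replicate k L ++ S′ R ks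
S′ R (k ∷ ks) = replicate k R ++ S′ L ks

S : List ℕ → Str
S = S′ R

decLast : List ℕ → List ℕ
decLast []            = []
decLast (q ∷ [])      = q ∸ 1 ∷ []
decLast (q ∷ q′ ∷ qs) = q ∷ decLast (q′ ∷ qs)

f : CF → Str
f v = S (decLast v)

fExt : CF → GStr
fExt []       = Linv
fExt (0 ∷ []) = Rinv
fExt v        = str (f v)

-- right multiplication by R⁻¹ / L⁻¹ (on the reversed string)

mulInv : Dir → GStr → List Dir → GStr
mulInv d g []       = g
mulInv L g (L ∷ rs) = str (reverse rs)
mulInv L g (R ∷ rs) = mulInv L g rs
mulInv R g (R ∷ rs) = str (reverse rs)
mulInv R g (L ∷ rs) = mulInv R g rs

P-L : Str → GStr
P-L s = mulInv R Rinv (reverse s)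

P-R : Str → GStr
P-R s = mulInv L Linv (reverse s)

-- r(ε) = 1, r(SL) = r(S) - 2^{-|SL|}, r(SR) = r(S) + 2^{-|SR|}

half^ : ℕ → ℚ
half^ zero    = 1ℚ
half^ (suc k) = ½ ℚ.* half^ k

-- racc a n s = value of r on (t ++ s) where |t| = n and r(t) = a
racc : ℚ → ℕ → Str → ℚ
racc a n []       = a
racc a n (L ∷ ds) = racc (a ℚ.- half^ (suc n)) (suc n) ds
racc a n (R ∷ ds) = racc (a ℚ.+ half^ (suc n)) (suc n) ds

r : Str → ℚ
r = racc 1ℚ 0

-- For the vertex v = label p (level length p):
-- w ∈ 𝒞 ∪ {[0],[ ]} has level strictly less than the level of v.
-- ([0] and [ ] have level -1.)

LevelBelow : CF → Str → Set
LevelBelow w p = (w ≡ 0 ∷ [] ⊎ w ≡ [])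
               ⊎ Σ Str λ p′ → label p′ ≡ w × length p′ ℕ.< length p

IsLargestBelow : CF → Str → Set
IsLargestBelow w p =
  LevelBelow w p × eval w <∞ eval (label p) ×
  (∀ w′ → LevelBelow w′ p → eval w′ <∞ eval (label p) → eval w′ ≤∞ eval w)

IsSmallestAbove : CF → Str → Set
IsSmallestAbove w p =
  LevelBelow w p × eval (label p) <∞ eval w ×
  (∀ w′ → LevelBelow w′ p → eval (label p) <∞ eval w′ → eval w ≤∞ eval w′)

-- Write a vertex as v = [pre, k].  Its children either raise k by one or split it as
-- k - 1, 2, and in both cases the string S(…) of the child is f v followed by the
-- expected letter; since f [1] = ε, f (label p) = p.  This gives (a) and, with label as
-- the inverse, the bijection and level statements of (c).
--
-- The value [pre, x] is a composite of the maps x ↦ q + 1/x, each order-reversing on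
-- [0, ∞]; this gives (b).  It also shows that the subtree of v lies in the open interval
-- between the values of its two parents [pre, k - 1] and [pre], and that each child's
-- interval is cut from its parent's at v.  So left subtrees lie below and right subtrees
-- above their root: the value order is the in-order of T_C, and so is the order of r,
-- which proves the rest of (c).  Finally no vertex of smaller level lies inside the
-- interval of v, so the endpoints of that interval, the parents, are the nearest
-- elements of smaller level on either side, which is (d).

module Submission where

open import Defs
open import Data.Nat as ℕ using (ℕ; zero; suc; _∸_; _<_; z≤n; s≤s)
import Data.Nat.Properties as ℕ
open import Data.Nat.Divisibility using (_∣_; divides; ∣m+n∣m⇒∣n; ∣1⇒≡1)
open import Data.Nat.Coprimality as Coprime using (1-coprimeTo)
open import Data.Integer as ℤ using (+_; +[1+_]; -[1+_])
import Data.Integer.Properties as ℤ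
open import Data.Rational as ℚ using (ℚ; mkℚ; 0ℚ; 1ℚ; ½)
import Data.Rational.Properties as ℚ
open import Data.Rational.Solver using (module +-*-Solver)
open import Data.List using (List; []; _∷_; _++_; _∷ʳ_; [_]; length; replicate; reverse)
open import Data.List.Properties
  using (++-assoc; ++-identityʳ; length-++; reverse-++; unfold-reverse; reverse-selfInverse)
open import Data.Bool using (Bool; true; false; not; if_then_else_)
open import Data.Unit using (⊤; tt)
open import Data.Empty using (⊥-elim)
open import Data.Product using (Σ; _×_; _,_; proj₁; proj₂)
open import Data.Sum using (_⊎_; inj₁; inj₂)
open import Function.Base using (_∘_)
open import Function.Bundles using (_⇔_; mk⇔)
open import Relation.Nullary using (¬_; yes; no)
open import Relation.Binary using (tri<; tri≈; tri>)
open import Relation.Binary.PropositionalEquality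
  using (_≡_; refl; sym; trans; cong; cong₂; subst; subst₂; module ≡-Reasoning)

-- Opaque: unfolding the gcd normalisation inside ℚ./ makes type checking several times slower.
opaque
  toℚ : ℕ → ℚ
  toℚ n = + n ℚ./ 1

  toℚ-def : ∀ n → toℚ n ≡ + n ℚ./ 1
  toℚ-def n = refl

toℚ-mkℚ : ∀ n → toℚ n ≡ mkℚ (+ n) 0 (Coprime.sym (1-coprimeTo n))
toℚ-mkℚ n = trans (toℚ-def n) (ℚ.normalize-coprime (Coprime.sym (1-coprimeTo n)))

toℚ-suc : ∀ n → toℚ n ℚ.+ 1ℚ ≡ toℚ (suc n)
toℚ-suc n rewrite toℚ-mkℚ n | ℤ.*-identityʳ (+ n) | ℕ.+-comm n 1 = sym (toℚ-def (suc n))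

toℚ-nonNeg : ∀ n → 0ℚ ℚ.≤ toℚ n
toℚ-nonNeg n rewrite toℚ-mkℚ n = ℚ.nonNegative⁻¹ _

p<p+q : ∀ p {q} → 0ℚ ℚ.< q → p ℚ.< p ℚ.+ q
p<p+q p 0<q = subst (ℚ._< p ℚ.+ _) (ℚ.+-identityʳ p) (ℚ.+-monoʳ-< p 0<q)

toℚ-<-suc : ∀ n → toℚ n ℚ.< toℚ (suc n)
toℚ-<-suc n = subst (toℚ n ℚ.<_) (toℚ-suc n) (p<p+q (toℚ n) (ℚ.*<* (ℤ.+<+ (s≤s z≤n))))

toℚ-mono-< : ∀ {m n} → m < n → toℚ m ℚ.< toℚ n
toℚ-mono-< {m} {suc n} (s≤s m≤n) with ℕ.m≤n⇒m<n∨m≡n m≤n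
... | inj₁ m<n  = ℚ.<-trans (toℚ-mono-< m<n) (toℚ-<-suc n)
... | inj₂ refl = toℚ-<-suc n

≤∧≢⇒pos : ∀ x → 0ℚ ℚ.≤ x → ¬ x ≡ 0ℚ → 0ℚ ℚ.< x
≤∧≢⇒pos x 0≤x x≢0 with ℚ.<-cmp 0ℚ x
... | tri< 0<x _ _ = 0<x
... | tri≈ _ 0≡x _ = ⊥-elim (x≢0 (sym 0≡x))
... | tri> _ _ x<0 = ⊥-elim (ℚ.<-irrefl refl (ℚ.≤-<-trans 0≤x x<0))

1/-pos : ∀ x (0<x : 0ℚ ℚ.< x) → 0ℚ ℚ.< (ℚ.1/ x) {{ℚ.>-nonZero 0<x}}
1/-pos (mkℚ +[1+ n ] _ _) _ = ℚ.positive⁻¹ _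
1/-pos (mkℚ (+ 0) _ _) (ℚ.*<* (ℤ.+<+ ()))
1/-pos (mkℚ -[1+ n ] _ _) (ℚ.*<* ())

1/-antimono-< : ∀ x y (0<x : 0ℚ ℚ.< x) (0<y : 0ℚ ℚ.< y) → x ℚ.< y →
                (ℚ.1/ y) {{ℚ.>-nonZero 0<y}} ℚ.< (ℚ.1/ x) {{ℚ.>-nonZero 0<x}}
1/-antimono-< (mkℚ +[1+ m ] d _) (mkℚ +[1+ n ] e _) _ _ (ℚ.*<* lt) =
  ℚ.*<* (subst₂ ℤ._<_ (ℤ.*-comm +[1+ m ] (+ suc e)) (ℤ.*-comm +[1+ n ] (+ suc d)) lt)
1/-antimono-< (mkℚ (+ 0) _ _) _ (ℚ.*<* (ℤ.+<+ ())) _ _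
1/-antimono-< (mkℚ -[1+ _ ] _ _) _ (ℚ.*<* ()) _ _
1/-antimono-< (mkℚ +[1+ _ ] _ _) (mkℚ (+ 0) _ _) _ (ℚ.*<* (ℤ.+<+ ())) _
1/-antimono-< (mkℚ +[1+ _ ] _ _) (mkℚ -[1+ _ ] _ _) _ (ℚ.*<* ()) _

-- The order on ℚ ∪ {∞}

NonNeg∞ : ℚ∞ → Set
NonNeg∞ (fin x) = 0ℚ ℚ.≤ x
NonNeg∞ ∞       = ⊤

<∞-trans : ∀ {a b c} → a <∞ b → b <∞ c → a <∞ c
<∞-trans {fin _} {fin _} {fin _} a<b b<c = ℚ.<-trans a<b b<c
<∞-trans {fin _} {fin _} {∞}     _   _   = tt

<∞-asym : ∀ {a b} → a <∞ b → ¬ b <∞ a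
<∞-asym {fin _} {fin _} a<b b<a = ℚ.<-asym a<b b<a

<∞-irrefl : ∀ {a} → ¬ a <∞ a
<∞-irrefl a<a = <∞-asym a<a a<a

≤∞-refl : ∀ {a} → a ≤∞ a
≤∞-refl {fin _} = ℚ.≤-refl
≤∞-refl {∞}     = tt

≡⇒≤∞ : ∀ {a b} → a ≡ b → a ≤∞ b
≡⇒≤∞ refl = ≤∞-refl

≤∞-∞ : ∀ a → a ≤∞ ∞
≤∞-∞ (fin _) = tt
≤∞-∞ ∞       = tt

≤∞-trans : ∀ {a b c} → a ≤∞ b → b ≤∞ c → a ≤∞ c
≤∞-trans {fin _} {fin _} {fin _} a≤b b≤c = ℚ.≤-trans a≤b b≤c
≤∞-trans {a}     {_}     {∞}     _   _   = ≤∞-∞ a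
≤∞-trans {∞}     {fin _} {fin _} ()  _
≤∞-trans {∞}     {∞}     {fin _} _   ()

<⇒≤∞ : ∀ {a b} → a <∞ b → a ≤∞ b
<⇒≤∞ {fin _} {fin _} a<b = ℚ.<⇒≤ a<b
<⇒≤∞ {fin _} {∞}     _   = tt

<-≤∞-trans : ∀ {a b c} → a <∞ b → b ≤∞ c → a <∞ c
<-≤∞-trans {fin _} {fin _} {fin _} a<b b≤c = ℚ.<-≤-trans a<b b≤c
<-≤∞-trans {fin _} {_}     {∞}     _   _   = tt

≤-<∞-trans : ∀ {a b c} → a ≤∞ b → b <∞ c → a <∞ c
≤-<∞-trans {fin _} {fin _} {fin _} a≤b b<c = ℚ.≤-<-trans a≤b b<c
≤-<∞-trans {fin _} {fin _} {∞}     _   _   = tt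
≤-<∞-trans {∞}     {∞}     {_}     _   ()

NonNeg∞-<-upward : ∀ {a b} → NonNeg∞ a → a <∞ b → NonNeg∞ b
NonNeg∞-<-upward {fin _} {fin _} 0≤a a<b = ℚ.≤-trans 0≤a (ℚ.<⇒≤ a<b)
NonNeg∞-<-upward {fin _} {∞}     _   _   = tt

-- The maps x ↦ q + 1/x and x ↦ [q₀,…,qₖ,x]

cfStep : ℕ → ℚ∞ → ℚ∞
cfStep q X = toℚ q +1/ X

withPrefix : List ℕ → ℚ∞ → ℚ∞
withPrefix []       X = X
withPrefix (q ∷ qs) X = cfStep q (withPrefix qs X)

withPrefix-++ : ∀ xs ys X → withPrefix (xs ++ ys) X ≡ withPrefix xs (withPrefix ys X)
withPrefix-++ []       ys X = refl
withPrefix-++ (q ∷ xs) ys X = cong (cfStep q) (withPrefix-++ xs ys X)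

eval-∷ : ∀ q qs → eval (q ∷ qs) ≡ cfStep q (eval qs)
eval-∷ q qs = cong (_+1/ eval qs) (sym (toℚ-def q))

eval-++ : ∀ xs ys → eval (xs ++ ys) ≡ withPrefix xs (eval ys)
eval-++ []       ys = refl
eval-++ (q ∷ xs) ys = trans (eval-∷ q (xs ++ ys)) (cong (cfStep q) (eval-++ xs ys))

cfStep-1 : ∀ q → cfStep q (fin (toℚ 1)) ≡ fin (toℚ (suc q))
cfStep-1 q rewrite toℚ-def 1 = cong fin (toℚ-suc q)

cfStep-nonNeg : ∀ q X → NonNeg∞ X → NonNeg∞ (cfStep q X)
cfStep-nonNeg q ∞       _   = toℚ-nonNeg q
cfStep-nonNeg q (fin x) 0≤x with x ℚ.≟ 0ℚ
... | yes _   = tt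
... | no  x≢0 = ℚ.+-mono-≤ (toℚ-nonNeg q) (ℚ.<⇒≤ (1/-pos x (≤∧≢⇒pos x 0≤x x≢0)))

cfStep-antitone : ∀ q X Y → NonNeg∞ X → X <∞ Y → cfStep q Y <∞ cfStep q X
cfStep-antitone q (fin x) ∞ 0≤x _ with x ℚ.≟ 0ℚ
... | yes _   = tt
... | no  x≢0 = p<p+q (toℚ q) (1/-pos x (≤∧≢⇒pos x 0≤x x≢0))
cfStep-antitone q (fin x) (fin y) 0≤x x<y with y ℚ.≟ 0ℚ | x ℚ.≟ 0ℚ
... | yes refl | _       = ⊥-elim (ℚ.<-irrefl refl (ℚ.≤-<-trans 0≤x x<y))
... | no  _    | yes _   = tt
... | no  y≢0  | no  x≢0 = ℚ.+-monoʳ-< (toℚ q) (1/-antimono-< x y 0<x 0<y x<y)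
  where
  0<x = ≤∧≢⇒pos x 0≤x x≢0
  0<y = ≤∧≢⇒pos y (ℚ.≤-trans 0≤x (ℚ.<⇒≤ x<y)) y≢0

withPrefix-nonNeg : ∀ xs X → NonNeg∞ X → NonNeg∞ (withPrefix xs X)
withPrefix-nonNeg []       X 0≤X = 0≤X
withPrefix-nonNeg (q ∷ xs) X 0≤X = cfStep-nonNeg q _ (withPrefix-nonNeg xs X 0≤X)

parity : Bool → List ℕ → Bool
parity b []       = b
parity b (_ ∷ xs) = parity (not b) xs

parity-∷ʳ : ∀ b xs x → parity b (xs ∷ʳ x) ≡ not (parity b xs)
parity-∷ʳ b []       x = refl
parity-∷ʳ b (_ ∷ xs) x = parity-∷ʳ (not b) xs x

parity-not : ∀ b xs → parity (not b) xs ≡ not (parity b xs)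
parity-not b []       = refl
parity-not b (_ ∷ xs) = parity-not (not b) xs

StrictlyMonotone : Bool → (ℚ∞ → ℚ∞) → Set
StrictlyMonotone true  g = ∀ X Y → NonNeg∞ X → X <∞ Y → g X <∞ g Y
StrictlyMonotone false g = ∀ X Y → NonNeg∞ X → X <∞ Y → g Y <∞ g X

cfStep-∘-reverses : ∀ q b g → (∀ X → NonNeg∞ X → NonNeg∞ (g X)) →
                    StrictlyMonotone b g → StrictlyMonotone (not b) (λ X → cfStep q (g X))
cfStep-∘-reverses q true  g g≥0 g↑ X Y 0≤X X<Y =
  cfStep-antitone q (g X) (g Y) (g≥0 X 0≤X) (g↑ X Y 0≤X X<Y)
cfStep-∘-reverses q false g g≥0 g↓ X Y 0≤X X<Y =
  cfStep-antitone q (g Y) (g X) (g≥0 Y (NonNeg∞-<-upward 0≤X X<Y)) (g↓ X Y 0≤X X<Y)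

withPrefix-monotone : ∀ xs → StrictlyMonotone (parity true xs) (withPrefix xs)
withPrefix-monotone []       X Y _ X<Y = X<Y
withPrefix-monotone (q ∷ xs) =
  subst (λ b → StrictlyMonotone b (withPrefix (q ∷ xs))) (sym (parity-not true xs))
    (cfStep-∘-reverses q (parity true xs) (withPrefix xs)
      (withPrefix-nonNeg xs) (withPrefix-monotone xs))

-- Vertices of T_C and the map f

HasPositiveLast : CF → Set
HasPositiveLast v = Σ (List ℕ) λ pre → Σ ℕ λ j → v ≡ pre ∷ʳ suc j

childL′-∷ʳ : ∀ b pre k → childL′ b (pre ∷ʳ k) ≡
             pre ++ (if parity b pre then (k ∸ 1 ∷ 2 ∷ []) else (suc k ∷ []))
childL′-∷ʳ b []            k = refl
childL′-∷ʳ b (x ∷ [])      k = refl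
childL′-∷ʳ b (x ∷ y ∷ pre) k = cong (x ∷_) (childL′-∷ʳ (not b) (y ∷ pre) k)

childR′-∷ʳ : ∀ b pre k → childR′ b (pre ∷ʳ k) ≡
             pre ++ (if parity b pre then (suc k ∷ []) else (k ∸ 1 ∷ 2 ∷ []))
childR′-∷ʳ b []            k = refl
childR′-∷ʳ b (x ∷ [])      k = refl
childR′-∷ʳ b (x ∷ y ∷ pre) k = cong (x ∷_) (childR′-∷ʳ (not b) (y ∷ pre) k)

++-pair : ∀ pre (a b : ℕ) → pre ++ (a ∷ b ∷ []) ≡ pre ∷ʳ a ∷ʳ b
++-pair pre a b = sym (++-assoc pre [ a ] [ b ])

CL-positive : ∀ {v} → HasPositiveLast v → HasPositiveLast (CL v)
CL-positive (pre , j , refl) rewrite childL′-∷ʳ true pre (suc j) with parity true pre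
... | true  = pre ∷ʳ j , 1 , ++-pair pre j 2
... | false = pre , suc j , refl

CR-positive : ∀ {v} → HasPositiveLast v → HasPositiveLast (CR v)
CR-positive (pre , j , refl) rewrite childR′-∷ʳ true pre (suc j) with parity true pre
... | true  = pre , suc j , refl
... | false = pre ∷ʳ j , 1 , ++-pair pre j 2

dirOf : Bool → Dir
dirOf true  = R
dirOf false = L

S′-++ : ∀ b xs ys → S′ (dirOf b) (xs ++ ys) ≡ S′ (dirOf b) xs ++ S′ (dirOf (parity b xs)) ys
S′-++ b     []       ys = refl
S′-++ true  (x ∷ xs) ys =
  trans (cong (replicate x R ++_) (S′-++ false xs ys)) (sym (++-assoc (replicate x R) _ _))
S′-++ false (x ∷ xs) ys =
  trans (cong (replicate x L ++_) (S′-++ true xs ys)) (sym (++-assoc (replicate x L) _ _))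

S′-singleton : ∀ d k → S′ d [ k ] ≡ replicate k d
S′-singleton L k = ++-identityʳ (replicate k L)
S′-singleton R k = ++-identityʳ (replicate k R)

replicate-suc-∷ʳ : ∀ {A : Set} n (x : A) → replicate (suc n) x ≡ replicate n x ∷ʳ x
replicate-suc-∷ʳ zero    x = refl
replicate-suc-∷ʳ (suc n) x = cong (x ∷_) (replicate-suc-∷ʳ n x)

decLast-∷ʳ : ∀ pre k → decLast (pre ∷ʳ k) ≡ pre ∷ʳ (k ∸ 1)
decLast-∷ʳ []            k = refl
decLast-∷ʳ (x ∷ [])      k = refl
decLast-∷ʳ (x ∷ y ∷ pre) k = cong (x ∷_) (decLast-∷ʳ (y ∷ pre) k)

S-∷ʳ : ∀ pre k → S (pre ∷ʳ k) ≡ S pre ++ replicate k (dirOf (parity true pre))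
S-∷ʳ pre k =
  trans (S′-++ true pre [ k ]) (cong (S pre ++_) (S′-singleton (dirOf (parity true pre)) k))

f-extend : ∀ pre j → f (pre ∷ʳ suc (suc j)) ≡ f (pre ∷ʳ suc j) ∷ʳ dirOf (parity true pre)
f-extend pre j = begin
  f (pre ∷ʳ suc (suc j))                ≡⟨ cong S (decLast-∷ʳ pre (suc (suc j))) ⟩
  S (pre ∷ʳ suc j)                      ≡⟨ S-∷ʳ pre (suc j) ⟩
  S pre ++ replicate (suc j) d          ≡⟨ cong (S pre ++_) (replicate-suc-∷ʳ j d) ⟩
  S pre ++ (replicate j d ∷ʳ d)         ≡⟨ sym (++-assoc (S pre) (replicate j d) [ d ]) ⟩
  (S pre ++ replicate j d) ∷ʳ d         ≡⟨ cong (_∷ʳ d) (sym (S-∷ʳ pre j)) ⟩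
  S (pre ∷ʳ j) ∷ʳ d                     ≡⟨ cong (λ xs → S xs ∷ʳ d) (sym (decLast-∷ʳ pre (suc j))) ⟩
  f (pre ∷ʳ suc j) ∷ʳ d                 ∎
  where
  open ≡-Reasoning
  d = dirOf (parity true pre)

f-split : ∀ pre j → f (pre ∷ʳ j ∷ʳ 2) ≡ f (pre ∷ʳ suc j) ∷ʳ dirOf (not (parity true pre))
f-split pre j = begin
  f (pre ∷ʳ j ∷ʳ 2)                      ≡⟨ cong S (decLast-∷ʳ (pre ∷ʳ j) 2) ⟩
  S (pre ∷ʳ j ∷ʳ 1)                      ≡⟨ S-∷ʳ (pre ∷ʳ j) 1 ⟩
  S (pre ∷ʳ j) ∷ʳ dirOf (parity true (pre ∷ʳ j))
    ≡⟨ cong (λ b → S (pre ∷ʳ j) ∷ʳ dirOf b) (parity-∷ʳ true pre j) ⟩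
  S (pre ∷ʳ j) ∷ʳ dirOf (not (parity true pre))
    ≡⟨ cong (λ xs → S xs ∷ʳ _) (sym (decLast-∷ʳ pre (suc j))) ⟩
  f (pre ∷ʳ suc j) ∷ʳ dirOf (not (parity true pre)) ∎
  where open ≡-Reasoning

f-CL : ∀ {v} → HasPositiveLast v → f (CL v) ≡ f v ∷ʳ L
f-CL (pre , j , refl) rewrite childL′-∷ʳ true pre (suc j)
  with parity true pre | f-split pre j | f-extend pre j
... | true  | split | _      = trans (cong f (++-pair pre j 2)) split
... | false | _     | extend = extend

f-CR : ∀ {v} → HasPositiveLast v → f (CR v) ≡ f v ∷ʳ R
f-CR (pre , j , refl) rewrite childR′-∷ʳ true pre (suc j)
  with parity true pre | f-split pre j | f-extend pre j
... | true  | _     | extend = extend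
... | false | split | _      = trans (cong f (++-pair pre j 2)) split

walk-++ : ∀ v p s → walk v (p ++ s) ≡ walk (walk v p) s
walk-++ v []      s = refl
walk-++ v (L ∷ p) s = walk-++ (CL v) p s
walk-++ v (R ∷ p) s = walk-++ (CR v) p s

walk-positive : ∀ {v} u → HasPositiveLast v → HasPositiveLast (walk v u)
walk-positive []      v⁺ = v⁺
walk-positive (L ∷ u) v⁺ = walk-positive u (CL-positive v⁺)
walk-positive (R ∷ u) v⁺ = walk-positive u (CR-positive v⁺)

root-positive : HasPositiveLast root
root-positive = [] , 0 , refl

label-positive : ∀ p → HasPositiveLast (label p)
label-positive p = walk-positive p root-positive

f-walk : ∀ {v} u → HasPositiveLast v → f (walk v u) ≡ f v ++ u
f-walk {v} []      _  = sym (++-identityʳ (f v))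
f-walk {v} (L ∷ u) v⁺ = begin
  f (walk (CL v) u)   ≡⟨ f-walk u (CL-positive v⁺) ⟩
  f (CL v) ++ u       ≡⟨ cong (_++ u) (f-CL v⁺) ⟩
  (f v ∷ʳ L) ++ u     ≡⟨ ++-assoc (f v) [ L ] u ⟩
  f v ++ L ∷ u        ∎
  where open ≡-Reasoning
f-walk {v} (R ∷ u) v⁺ = begin
  f (walk (CR v) u)   ≡⟨ f-walk u (CR-positive v⁺) ⟩
  f (CR v) ++ u       ≡⟨ cong (_++ u) (f-CR v⁺) ⟩
  (f v ∷ʳ R) ++ u     ≡⟨ ++-assoc (f v) [ R ] u ⟩
  f v ++ R ∷ u        ∎
  where open ≡-Reasoning

f-label : ∀ p → f (label p) ≡ p
f-label p = f-walk p root-positive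

-- Intervals of subtrees

evalAtLast : (Bool → ℕ → ℚ∞) → Bool → CF → ℚ∞
evalAtLast g b []            = ∞
evalAtLast g b (q ∷ [])      = g b q
evalAtLast g b (q ∷ q′ ∷ qs) = cfStep q (evalAtLast g (not b) (q′ ∷ qs))

evalAtLast-∷ʳ : ∀ g b pre k → evalAtLast g b (pre ∷ʳ k) ≡ withPrefix pre (g (parity b pre) k)
evalAtLast-∷ʳ g b []            k = refl
evalAtLast-∷ʳ g b (x ∷ [])      k = refl
evalAtLast-∷ʳ g b (x ∷ y ∷ pre) k = cong (cfStep x) (evalAtLast-∷ʳ g (not b) (y ∷ pre) k)

evalAtLast-split : ∀ g pre j →
                   evalAtLast g true (pre ∷ʳ j ∷ʳ 2) ≡
                   withPrefix pre (cfStep j (g (not (parity true pre)) 2))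
evalAtLast-split g pre j = begin
  evalAtLast g true (pre ∷ʳ j ∷ʳ 2)                          ≡⟨ evalAtLast-∷ʳ g true (pre ∷ʳ j) 2 ⟩
  withPrefix (pre ∷ʳ j) (g (parity true (pre ∷ʳ j)) 2)
    ≡⟨ cong (λ b → withPrefix (pre ∷ʳ j) (g b 2)) (parity-∷ʳ true pre j) ⟩
  withPrefix (pre ∷ʳ j) (g (not (parity true pre)) 2)    ≡⟨ withPrefix-++ pre [ j ] _ ⟩
  withPrefix pre (cfStep j (g (not (parity true pre)) 2)) ∎
  where open ≡-Reasoning

lowerEnd upperEnd : Bool → ℕ → ℚ∞
lowerEnd b k = if b then fin (toℚ (k ∸ 1)) else ∞
upperEnd b k = if b then ∞ else fin (toℚ (k ∸ 1))

-- lo v and hi v are the values of the parents of v = [pre, k], namely [pre, k - 1] and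
-- [pre] in the order given by the parity of the length of pre.
lo hi : CF → ℚ∞
lo = evalAtLast lowerEnd true
hi = evalAtLast upperEnd true

eval-∷ʳ : ∀ pre k → eval (pre ∷ʳ k) ≡ withPrefix pre (fin (toℚ k))
eval-∷ʳ pre k = trans (eval-++ pre [ k ]) (cong (withPrefix pre) (eval-∷ k []))

eval-in-interval : ∀ {v} → HasPositiveLast v → lo v <∞ eval v × eval v <∞ hi v
eval-in-interval (pre , j , refl)
  rewrite evalAtLast-∷ʳ lowerEnd true pre (suc j) | evalAtLast-∷ʳ upperEnd true pre (suc j)
        | eval-∷ʳ pre (suc j)
  with parity true pre | withPrefix-monotone pre
... | true  | mono = mono _ _ (toℚ-nonNeg j) (toℚ-<-suc j) , mono _ ∞ (toℚ-nonNeg (suc j)) tt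
... | false | mono = mono _ ∞ (toℚ-nonNeg (suc j)) tt , mono _ _ (toℚ-nonNeg j) (toℚ-<-suc j)

CL-interval : ∀ {v} → HasPositiveLast v → lo (CL v) ≡ lo v × hi (CL v) ≡ eval v
CL-interval (pre , j , refl)
  rewrite childL′-∷ʳ true pre (suc j) | eval-∷ʳ pre (suc j)
        | evalAtLast-∷ʳ lowerEnd true pre (suc j)
  with parity true pre in e
... | true
  rewrite ++-pair pre j 2 | evalAtLast-split lowerEnd pre j | evalAtLast-split upperEnd pre j | e =
  refl , cong (withPrefix pre) (cfStep-1 j)
... | false
  rewrite evalAtLast-∷ʳ lowerEnd true pre (suc (suc j)) | evalAtLast-∷ʳ upperEnd true pre (suc (suc j))
        | e =
  refl , refl

CR-interval : ∀ {v} → HasPositiveLast v → lo (CR v) ≡ eval v × hi (CR v) ≡ hi v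
CR-interval (pre , j , refl)
  rewrite childR′-∷ʳ true pre (suc j) | eval-∷ʳ pre (suc j)
        | evalAtLast-∷ʳ upperEnd true pre (suc j)
  with parity true pre in e
... | false
  rewrite ++-pair pre j 2 | evalAtLast-split lowerEnd pre j | evalAtLast-split upperEnd pre j | e =
  cong (withPrefix pre) (cfStep-1 j) , refl
... | true
  rewrite evalAtLast-∷ʳ lowerEnd true pre (suc (suc j)) | evalAtLast-∷ʳ upperEnd true pre (suc (suc j))
        | e =
  refl , refl

record _⊆ᵢ_ (w v : CF) : Set where
  constructor nested
  field
    lo-≤ : lo v ≤∞ lo w
    hi-≤ : hi w ≤∞ hi v
open _⊆ᵢ_

⊆ᵢ-refl : ∀ {v} → v ⊆ᵢ v
⊆ᵢ-refl = nested ≤∞-refl ≤∞-refl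

⊆ᵢ-trans : ∀ {u v w} → u ⊆ᵢ v → v ⊆ᵢ w → u ⊆ᵢ w
⊆ᵢ-trans (nested lo≤ hi≤) (nested lo≤′ hi≤′) = nested (≤∞-trans lo≤′ lo≤) (≤∞-trans hi≤ hi≤′)

CL-⊆ᵢ : ∀ {v} → HasPositiveLast v → CL v ⊆ᵢ v
CL-⊆ᵢ v⁺ = nested (≡⇒≤∞ (sym (proj₁ (CL-interval v⁺))))
                  (≤∞-trans (≡⇒≤∞ (proj₂ (CL-interval v⁺))) (<⇒≤∞ (proj₂ (eval-in-interval v⁺))))

CR-⊆ᵢ : ∀ {v} → HasPositiveLast v → CR v ⊆ᵢ v
CR-⊆ᵢ v⁺ = nested (≤∞-trans (<⇒≤∞ (proj₁ (eval-in-interval v⁺)))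
                            (≡⇒≤∞ (sym (proj₁ (CR-interval v⁺)))))
                  (≡⇒≤∞ (proj₂ (CR-interval v⁺)))

walk-⊆ᵢ : ∀ {v} u → HasPositiveLast v → walk v u ⊆ᵢ v
walk-⊆ᵢ []      _  = ⊆ᵢ-refl
walk-⊆ᵢ (L ∷ u) v⁺ = ⊆ᵢ-trans (walk-⊆ᵢ u (CL-positive v⁺)) (CL-⊆ᵢ v⁺)
walk-⊆ᵢ (R ∷ u) v⁺ = ⊆ᵢ-trans (walk-⊆ᵢ u (CR-positive v⁺)) (CR-⊆ᵢ v⁺)

hi-walk-CL≤eval : ∀ {v} u → HasPositiveLast v → hi (walk (CL v) u) ≤∞ eval v
hi-walk-CL≤eval u v⁺ =
  ≤∞-trans (hi-≤ (walk-⊆ᵢ u (CL-positive v⁺))) (≡⇒≤∞ (proj₂ (CL-interval v⁺)))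

eval≤lo-walk-CR : ∀ {v} u → HasPositiveLast v → eval v ≤∞ lo (walk (CR v) u)
eval≤lo-walk-CR u v⁺ =
  ≤∞-trans (≡⇒≤∞ (sym (proj₁ (CR-interval v⁺)))) (lo-≤ (walk-⊆ᵢ u (CR-positive v⁺)))

walk-CL-below : ∀ {v} u → HasPositiveLast v → eval (walk (CL v) u) <∞ eval v
walk-CL-below u v⁺ =
  <-≤∞-trans (proj₂ (eval-in-interval (walk-positive u (CL-positive v⁺)))) (hi-walk-CL≤eval u v⁺)

walk-CR-above : ∀ {v} u → HasPositiveLast v → eval v <∞ eval (walk (CR v) u)
walk-CR-above u v⁺ =
  ≤-<∞-trans (eval≤lo-walk-CR u v⁺) (proj₁ (eval-in-interval (walk-positive u (CR-positive v⁺))))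

shallower-outside : ∀ {v} p p′ → HasPositiveLast v → length p′ < length p →
                    eval (walk v p′) ≤∞ lo (walk v p) ⊎ hi (walk v p) ≤∞ eval (walk v p′)
shallower-outside (L ∷ p) []       v⁺ _ = inj₂ (hi-walk-CL≤eval p v⁺)
shallower-outside (R ∷ p) []       v⁺ _ = inj₁ (eval≤lo-walk-CR p v⁺)
shallower-outside (L ∷ p) (L ∷ p′) v⁺ (s≤s lt) = shallower-outside p p′ (CL-positive v⁺) lt
shallower-outside (R ∷ p) (R ∷ p′) v⁺ (s≤s lt) = shallower-outside p p′ (CR-positive v⁺) lt
shallower-outside (L ∷ p) (R ∷ p′) v⁺ _ =
  inj₂ (<⇒≤∞ (≤-<∞-trans (hi-walk-CL≤eval p v⁺) (walk-CR-above p′ v⁺)))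
shallower-outside (R ∷ p) (L ∷ p′) v⁺ _ =
  inj₁ (<⇒≤∞ (<-≤∞-trans (walk-CL-below p′ v⁺) (eval≤lo-walk-CR p v⁺)))

-- The dyadic map r

half^-pos : ∀ n → 0ℚ ℚ.< half^ n
half^-pos zero    = ℚ.*<* (ℤ.+<+ (s≤s z≤n))
half^-pos (suc n) = ℚ.*-monoʳ-<-pos ½ (half^-pos n)

module _ where
  open +-*-Solver

  half^-suc-twice : ∀ n → half^ (suc n) ℚ.+ half^ (suc n) ≡ half^ n
  half^-suc-twice n = solve 1 (λ h → con ½ :* h :+ con ½ :* h := h) refl (half^ n)

  -‿+-cancel : ∀ a h → (a ℚ.- h) ℚ.+ h ≡ a
  -‿+-cancel = solve 2 (λ a h → (a :- h) :+ h := a) refl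

  +‿-‿cancel : ∀ a h → (a ℚ.+ h) ℚ.- h ≡ a
  +‿-‿cancel = solve 2 (λ a h → (a :+ h) :- h := a) refl

  -‿-‿assoc : ∀ a h → (a ℚ.- h) ℚ.- h ≡ a ℚ.- (h ℚ.+ h)
  -‿-‿assoc = solve 2 (λ a h → (a :- h) :- h := a :- (h :+ h)) refl

  +‿+‿assoc : ∀ a h → (a ℚ.+ h) ℚ.+ h ≡ a ℚ.+ (h ℚ.+ h)
  +‿+‿assoc = solve 2 (λ a h → (a :+ h) :+ h := a :+ (h :+ h)) refl

p-q<p : ∀ p {q} → 0ℚ ℚ.< q → p ℚ.- q ℚ.< p
p-q<p p {q} 0<q = subst (p ℚ.- q ℚ.<_) (-‿+-cancel p q) (p<p+q (p ℚ.- q) 0<q)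

racc-bounds : ∀ a n u → a ℚ.- half^ n ℚ.< racc a n u × racc a n u ℚ.< a ℚ.+ half^ n
racc-bounds a n []      = p-q<p a (half^-pos n) , p<p+q a (half^-pos n)
racc-bounds a n (L ∷ u) =
  subst (ℚ._< rest) (trans (-‿-‿assoc a h) (cong (λ x → a ℚ.- x) (half^-suc-twice n))) lower ,
  ℚ.<-trans (subst (rest ℚ.<_) (-‿+-cancel a h) upper) (p<p+q a (half^-pos n))
  where
  h    = half^ (suc n)
  rest = racc (a ℚ.- h) (suc n) u
  lower = proj₁ (racc-bounds (a ℚ.- h) (suc n) u)
  upper = proj₂ (racc-bounds (a ℚ.- h) (suc n) u)
racc-bounds a n (R ∷ u) =
  ℚ.<-trans (p-q<p a (half^-pos n)) (subst (ℚ._< rest) (+‿-‿cancel a h) lower) ,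
  subst (rest ℚ.<_) (trans (+‿+‿assoc a h) (cong (a ℚ.+_) (half^-suc-twice n))) upper
  where
  h    = half^ (suc n)
  rest = racc (a ℚ.+ h) (suc n) u
  lower = proj₁ (racc-bounds (a ℚ.+ h) (suc n) u)
  upper = proj₂ (racc-bounds (a ℚ.+ h) (suc n) u)

racc-L< : ∀ a n u → racc a n (L ∷ u) ℚ.< a
racc-L< a n u =
  subst (racc a n (L ∷ u) ℚ.<_) (-‿+-cancel a h) (proj₂ (racc-bounds (a ℚ.- h) (suc n) u))
  where h = half^ (suc n)

racc-R> : ∀ a n u → a ℚ.< racc a n (R ∷ u)
racc-R> a n u =
  subst (ℚ._< racc a n (R ∷ u)) (+‿-‿cancel a h) (proj₁ (racc-bounds (a ℚ.+ h) (suc n) u))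
  where h = half^ (suc n)

racc-++ : ∀ a n c s → racc a n (c ++ s) ≡ racc (racc a n c) (length c ℕ.+ n) s
racc-++ a n []      s = refl
racc-++ a n (L ∷ c) s =
  trans (racc-++ a′ (suc n) c s) (cong (λ m → racc (racc a′ (suc n) c) m s) (ℕ.+-suc (length c) n))
  where a′ = a ℚ.- half^ (suc n)
racc-++ a n (R ∷ c) s =
  trans (racc-++ a′ (suc n) c s) (cong (λ m → racc (racc a′ (suc n) c) m s) (ℕ.+-suc (length c) n))
  where a′ = a ℚ.+ half^ (suc n)

r-++L< : ∀ c u → r (c ++ L ∷ u) ℚ.< r c
r-++L< c u rewrite racc-++ 1ℚ 0 c (L ∷ u) = racc-L< (r c) (length c ℕ.+ 0) u

r-++R> : ∀ c u → r c ℚ.< r (c ++ R ∷ u)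
r-++R> c u rewrite racc-++ 1ℚ 0 c (R ∷ u) = racc-R> (r c) (length c ℕ.+ 0) u

-- In-order precedence of tree positions

data Before : Str → Str → Set where
  fork   : ∀ c u u′ → Before (c ++ L ∷ u) (c ++ R ∷ u′)
  left   : ∀ c u → Before (c ++ L ∷ u) c
  right  : ∀ c u → Before c (c ++ R ∷ u)

Before-∷ : ∀ d {p p′} → Before p p′ → Before (d ∷ p) (d ∷ p′)
Before-∷ d (fork c u u′) = fork (d ∷ c) u u′
Before-∷ d (left c u)    = left (d ∷ c) u
Before-∷ d (right c u)   = right (d ∷ c) u

Trichotomous : Str → Str → Set
Trichotomous p p′ = Before p p′ ⊎ p ≡ p′ ⊎ Before p′ p

Trichotomous-∷ : ∀ d {u u′} → Trichotomous u u′ → Trichotomous (d ∷ u) (d ∷ u′)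
Trichotomous-∷ d (inj₁ b)           = inj₁ (Before-∷ d b)
Trichotomous-∷ d (inj₂ (inj₁ refl)) = inj₂ (inj₁ refl)
Trichotomous-∷ d (inj₂ (inj₂ b))    = inj₂ (inj₂ (Before-∷ d b))

Before-trichotomy : ∀ p p′ → Trichotomous p p′
Before-trichotomy []      []       = inj₂ (inj₁ refl)
Before-trichotomy []      (L ∷ u)  = inj₂ (inj₂ (left [] u))
Before-trichotomy []      (R ∷ u)  = inj₁ (right [] u)
Before-trichotomy (L ∷ u) []       = inj₁ (left [] u)
Before-trichotomy (R ∷ u) []       = inj₂ (inj₂ (right [] u))
Before-trichotomy (L ∷ u) (R ∷ u′) = inj₁ (fork [] u u′)
Before-trichotomy (R ∷ u) (L ∷ u′) = inj₂ (inj₂ (fork [] u′ u))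
Before-trichotomy (L ∷ u) (L ∷ u′) = Trichotomous-∷ L (Before-trichotomy u u′)
Before-trichotomy (R ∷ u) (R ∷ u′) = Trichotomous-∷ R (Before-trichotomy u u′)

-- Before is trichotomous, so it determines every asymmetric relation containing it
Before-maximal : ∀ {A B : Set} {_<_ : A → A → Set} {_≺_ : B → B → Set}
                 (g : Str → A) (h : Str → B) → (∀ {a b} → a < b → ¬ b < a) →
                 (∀ {p p′} → Before p p′ → g p < g p′) → (∀ {p p′} → Before p p′ → h p ≺ h p′) →
                 ∀ p p′ → g p < g p′ → h p ≺ h p′
Before-maximal g h <-asym B⇒g< B⇒h≺ p p′ gp<gp′ with Before-trichotomy p p′
... | inj₁ b           = B⇒h≺ b
... | inj₂ (inj₁ refl) = ⊥-elim (<-asym gp<gp′ gp<gp′)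
... | inj₂ (inj₂ b)    = ⊥-elim (<-asym gp<gp′ (B⇒g< b))

Before⇒eval< : ∀ {p p′} → Before p p′ → eval (label p) <∞ eval (label p′)
Before⇒eval< (fork c u u′) = <∞-trans (Before⇒eval< (left c u)) (Before⇒eval< (right c u′))
Before⇒eval< (left c u)
  rewrite walk-++ root c (L ∷ u) = walk-CL-below u (label-positive c)
Before⇒eval< (right c u)
  rewrite walk-++ root c (R ∷ u) = walk-CR-above u (label-positive c)

Before⇒r< : ∀ {p p′} → Before p p′ → r p ℚ.< r p′
Before⇒r< (fork c u u′) = ℚ.<-trans (r-++L< c u) (r-++R> c u′)
Before⇒r< (left c u)    = r-++L< c u
Before⇒r< (right c u)   = r-++R> c u

eval<⇔r< : ∀ p p′ → eval (label p) <∞ eval (label p′) ⇔ r p ℚ.< r p′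
eval<⇔r< p p′ = mk⇔
  (Before-maximal {_<_ = _<∞_} {ℚ._<_} (eval ∘ label) r <∞-asym Before⇒eval< Before⇒r< p p′)
  (Before-maximal {_<_ = ℚ._<_} {_<∞_} r (eval ∘ label) ℚ.<-asym Before⇒r< Before⇒eval< p p′)

-- Monotonicity in the last entry

parity-true⇒even : ∀ xs → parity true xs ≡ true → 2 ∣ length xs
parity-true⇒even []           _ = divides 0 refl
parity-true⇒even (_ ∷ _ ∷ xs) e with parity-true⇒even xs e
... | divides q eq = divides (suc q) (cong (λ n → suc (suc n)) eq)

parity-false⇒odd : ∀ xs → parity true xs ≡ false → ¬ 2 ∣ length xs
parity-false⇒odd (_ ∷ [])     _ 2∣1 with ∣1⇒≡1 2∣1
... | ()
parity-false⇒odd (_ ∷ _ ∷ xs) e 2∣n+2 = parity-false⇒odd xs e (∣m+n∣m⇒∣n 2∣n+2 (divides 1 refl))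

eval-last-monotone : ∀ pre a b → a < b →
                     (2 ∣ length pre → eval (pre ∷ʳ a) <∞ eval (pre ∷ʳ b))
                   × (¬ 2 ∣ length pre → eval (pre ∷ʳ b) <∞ eval (pre ∷ʳ a))
eval-last-monotone pre a b a<b rewrite eval-∷ʳ pre a | eval-∷ʳ pre b
  with parity true pre in e | withPrefix-monotone pre
... | true  | increasing = (λ _ → increasing _ _ (toℚ-nonNeg a) (toℚ-mono-< a<b))
                         , (λ odd → ⊥-elim (odd (parity-true⇒even pre e)))
... | false | decreasing = (λ even → ⊥-elim (parity-false⇒odd pre e even))
                         , (λ _ → decreasing _ _ (toℚ-nonNeg a) (toℚ-mono-< a<b))

-- Parents

flip : Dir → Dir
flip L = R
flip R = L

mulInv-view : ∀ d g t →
  (Σ Str λ c′ → Σ ℕ λ k → t ≡ replicate k (flip d) ++ d ∷ c′ × mulInv d g t ≡ str (reverse c′))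
  ⊎ (Σ ℕ λ k → t ≡ replicate k (flip d) × mulInv d g t ≡ g)
mulInv-view d g [] = inj₂ (0 , refl , refl)
mulInv-view L g (L ∷ t) = inj₁ (t , 0 , refl , refl)
mulInv-view R g (R ∷ t) = inj₁ (t , 0 , refl , refl)
mulInv-view L g (R ∷ t) with mulInv-view L g t
... | inj₁ (c′ , k , refl , e) = inj₁ (c′ , suc k , refl , e)
... | inj₂ (k , refl , e)      = inj₂ (suc k , refl , e)
mulInv-view R g (L ∷ t) with mulInv-view R g t
... | inj₁ (c′ , k , refl , e) = inj₁ (c′ , suc k , refl , e)
... | inj₂ (k , refl , e)      = inj₂ (suc k , refl , e)

reverse-replicate : ∀ {A : Set} k (x : A) → reverse (replicate k x) ≡ replicate k x
reverse-replicate zero    x = refl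
reverse-replicate (suc k) x = begin
  reverse (x ∷ replicate k x)    ≡⟨ unfold-reverse x (replicate k x) ⟩
  reverse (replicate k x) ∷ʳ x   ≡⟨ cong (_∷ʳ x) (reverse-replicate k x) ⟩
  replicate k x ∷ʳ x             ≡⟨ sym (replicate-suc-∷ʳ k x) ⟩
  replicate (suc k) x            ∎
  where open ≡-Reasoning

reverse-replicate-++ : ∀ {A : Set} k (x y : A) zs →
                       reverse (replicate k x ++ y ∷ zs) ≡ reverse zs ++ y ∷ replicate k x
reverse-replicate-++ k x y zs = begin
  reverse (replicate k x ++ y ∷ zs)               ≡⟨ reverse-++ (replicate k x) (y ∷ zs) ⟩
  reverse (y ∷ zs) ++ reverse (replicate k x)
    ≡⟨ cong₂ _++_ (unfold-reverse y zs) (reverse-replicate k x) ⟩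
  (reverse zs ∷ʳ y) ++ replicate k x              ≡⟨ ++-assoc (reverse zs) [ y ] (replicate k x) ⟩
  reverse zs ++ y ∷ replicate k x                 ∎
  where open ≡-Reasoning

parent-view : ∀ d g p →
  (Σ Str λ c → Σ ℕ λ k → p ≡ c ++ d ∷ replicate k (flip d) × mulInv d g (reverse p) ≡ str c)
  ⊎ (Σ ℕ λ k → p ≡ replicate k (flip d) × mulInv d g (reverse p) ≡ g)
parent-view d g p with mulInv-view d g (reverse p)
... | inj₁ (c′ , k , eq , e) =
  inj₁ (reverse c′ , k ,
        trans (sym (reverse-selfInverse eq)) (reverse-replicate-++ k (flip d) d c′) , e)
... | inj₂ (k , eq , e) =
  inj₂ (k , trans (sym (reverse-selfInverse eq)) (reverse-replicate k (flip d)) , e)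

fExt-positive : ∀ {v} → HasPositiveLast v → fExt v ≡ str (f v)
fExt-positive ([]                , j , refl) = refl
fExt-positive ((zero  ∷ [])      , j , refl) = refl
fExt-positive ((zero  ∷ _ ∷ _)   , j , refl) = refl
fExt-positive ((suc _ ∷ _)       , j , refl) = refl

fExt-label : ∀ p → fExt (label p) ≡ str p
fExt-label p = trans (fExt-positive (label-positive p)) (cong str (f-label p))

str-injective : ∀ {s t} → str s ≡ str t → s ≡ t
str-injective refl = refl

fExt-injective : ∀ {w w′} → InExt w → InExt w′ → fExt w ≡ fExt w′ → w ≡ w′
fExt-injective (inj₁ (p , refl)) (inj₁ (p′ , refl)) e =
  cong label (str-injective (trans (sym (fExt-label p)) (trans e (fExt-label p′))))
fExt-injective (inj₁ (p , refl)) (inj₂ (inj₁ refl)) e with trans (sym (fExt-label p)) e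
... | ()
fExt-injective (inj₁ (p , refl)) (inj₂ (inj₂ refl)) e with trans (sym (fExt-label p)) e
... | ()
fExt-injective (inj₂ (inj₁ refl)) (inj₁ (p′ , refl)) e with trans e (fExt-label p′)
... | ()
fExt-injective (inj₂ (inj₂ refl)) (inj₁ (p′ , refl)) e with trans e (fExt-label p′)
... | ()
fExt-injective (inj₂ (inj₁ refl)) (inj₂ (inj₁ refl)) _ = refl
fExt-injective (inj₂ (inj₂ refl)) (inj₂ (inj₂ refl)) _ = refl
fExt-injective (inj₂ (inj₁ refl)) (inj₂ (inj₂ refl)) ()
fExt-injective (inj₂ (inj₂ refl)) (inj₂ (inj₁ refl)) ()

lo-walk-L : ∀ {v} k → HasPositiveLast v → lo (walk v (replicate k L)) ≡ lo v
lo-walk-L zero    _  = refl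
lo-walk-L (suc k) v⁺ = trans (lo-walk-L k (CL-positive v⁺)) (proj₁ (CL-interval v⁺))

hi-walk-R : ∀ {v} k → HasPositiveLast v → hi (walk v (replicate k R)) ≡ hi v
hi-walk-R zero    _  = refl
hi-walk-R (suc k) v⁺ = trans (hi-walk-R k (CR-positive v⁺)) (proj₂ (CR-interval v⁺))

lo-below-R : ∀ c k → lo (label (c ++ R ∷ replicate k L)) ≡ eval (label c)
lo-below-R c k rewrite walk-++ root c (R ∷ replicate k L) =
  trans (lo-walk-L k (CR-positive (label-positive c))) (proj₁ (CR-interval (label-positive c)))

hi-below-L : ∀ c k → hi (label (c ++ L ∷ replicate k R)) ≡ eval (label c)
hi-below-L c k rewrite walk-++ root c (L ∷ replicate k R) =
  trans (hi-walk-R k (CL-positive (label-positive c))) (proj₂ (CL-interval (label-positive c)))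

eval-zero : eval (0 ∷ []) ≡ lo root
eval-zero = eval-∷ 0 []

zero≤lo : ∀ p → eval (0 ∷ []) ≤∞ lo (label p)
zero≤lo p = ≤∞-trans (≡⇒≤∞ eval-zero) (lo-≤ (walk-⊆ᵢ p root-positive))

lo-isLargestBelow : ∀ p w → LevelBelow w p → eval w ≡ lo (label p) → IsLargestBelow w p
lo-isLargestBelow p w w-below w≡lo =
  w-below , subst (_<∞ eval (label p)) (sym w≡lo) lo<v , largest
  where
  lo<v = proj₁ (eval-in-interval (label-positive p))
  v<hi = proj₂ (eval-in-interval (label-positive p))
  largest : ∀ w′ → LevelBelow w′ p → eval w′ <∞ eval (label p) → eval w′ ≤∞ eval w
  largest _ (inj₁ (inj₁ refl)) _  = subst (eval (0 ∷ []) ≤∞_) (sym w≡lo) (zero≤lo p)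
  largest _ (inj₁ (inj₂ refl)) ()
  largest _ (inj₂ (p′ , refl , shorter)) w′<v with shallower-outside p p′ root-positive shorter
  ... | inj₁ w′≤lo = subst (eval (label p′) ≤∞_) (sym w≡lo) w′≤lo
  ... | inj₂ hi≤w′ = ⊥-elim (<∞-irrefl (≤-<∞-trans hi≤w′ (<∞-trans w′<v v<hi)))

hi-isSmallestAbove : ∀ p w → LevelBelow w p → eval w ≡ hi (label p) → IsSmallestAbove w p
hi-isSmallestAbove p w w-below w≡hi =
  w-below , subst (eval (label p) <∞_) (sym w≡hi) v<hi , smallest
  where
  lo<v = proj₁ (eval-in-interval (label-positive p))
  v<hi = proj₂ (eval-in-interval (label-positive p))
  smallest : ∀ w′ → LevelBelow w′ p → eval (label p) <∞ eval w′ → eval w ≤∞ eval w′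
  smallest _ (inj₁ (inj₁ refl)) v<0 =
    ⊥-elim (<∞-irrefl (≤-<∞-trans (zero≤lo p) (<∞-trans lo<v v<0)))
  smallest _ (inj₁ (inj₂ refl)) _ = ≤∞-∞ (eval w)
  smallest _ (inj₂ (p′ , refl , shorter)) v<w′ with shallower-outside p p′ root-positive shorter
  ... | inj₁ w′≤lo = ⊥-elim (<∞-irrefl (≤-<∞-trans w′≤lo (<∞-trans lo<v v<w′)))
  ... | inj₂ hi≤w′ = subst (_≤∞ eval (label p′)) (sym w≡hi) hi≤w′

length-<-++ : ∀ (c : Str) d s → length c < length (c ++ d ∷ s)
length-<-++ c d s = subst (length c <_) (sym (length-++ c)) (ℕ.m<m+n (length c) (s≤s z≤n))

left-parent : ∀ p → Σ CF λ w → InExt w × fExt w ≡ P-L p × IsLargestBelow w p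
left-parent p with parent-view R Rinv p
... | inj₁ (c , k , refl , e) =
  label c , inj₁ (c , refl) , trans (fExt-label c) (sym e) ,
  lo-isLargestBelow (c ++ R ∷ replicate k L) (label c)
    (inj₂ (c , refl , length-<-++ c R _)) (sym (lo-below-R c k))
... | inj₂ (k , refl , e) =
  0 ∷ [] , inj₂ (inj₁ refl) , sym e ,
  lo-isLargestBelow (replicate k L) (0 ∷ [])
    (inj₁ (inj₁ refl)) (trans eval-zero (sym (lo-walk-L k root-positive)))

right-parent : ∀ p → Σ CF λ w → InExt w × fExt w ≡ P-R p × IsSmallestAbove w p
right-parent p with parent-view L Linv p
... | inj₁ (c , k , refl , e) =
  label c , inj₁ (c , refl) , trans (fExt-label c) (sym e) ,
  hi-isSmallestAbove (c ++ L ∷ replicate k R) (label c)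
    (inj₂ (c , refl , length-<-++ c L _)) (sym (hi-below-L c k))
... | inj₂ (k , refl , e) =
  [] , inj₂ (inj₂ refl) , sym e ,
  hi-isSmallestAbove (replicate k R) [] (inj₁ (inj₂ refl)) (sym (hi-walk-R k root-positive))

fExt-preimage-unique : ∀ {g} (P : CF → Set) → (Σ CF λ w → InExt w × fExt w ≡ g × P w) →
                       (Σ CF λ w → InExt w × fExt w ≡ g) × (∀ w → InExt w → fExt w ≡ g → P w)
fExt-preimage-unique P (w₀ , w₀∈ , w₀↦g , Pw₀) =
  (w₀ , w₀∈ , w₀↦g) ,
  λ w w∈ w↦g → subst P (fExt-injective w₀∈ w∈ (trans w₀↦g (sym w↦g))) Pw₀

theorem3p1 :
    (∀ (p : Str) → f (label p) ≡ p)
    × (∀ (pre : List ℕ) (a b : ℕ) → InC (pre ++ a ∷ []) → InC (pre ++ b ∷ []) → a < b →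
         (2 ∣ length pre → eval (pre ++ a ∷ []) <∞ eval (pre ++ b ∷ []))
         × (¬ (2 ∣ length pre) → eval (pre ++ b ∷ []) <∞ eval (pre ++ a ∷ [])))
    × ((∀ v v′ → InC v → InC v′ → f v ≡ f v′ → v ≡ v′)
       × (∀ (s : Str) → Σ CF λ v → InC v × f v ≡ s)
       × (∀ (p : Str) → length p ≡ length (f (label p)))
       × (∀ v → InC v → f (CL v) ≡ f v ++ L ∷ [] × f (CR v) ≡ f v ++ R ∷ [])
       × (∀ v v′ → InC v → InC v′ → (eval v <∞ eval v′ ⇔ r (f v) ℚ.< r (f v′))))
    × (∀ (p : Str) →
         ((Σ CF λ w → InExt w × fExt w ≡ P-L (f (label p)))
          × (∀ w → InExt w → fExt w ≡ P-L (f (label p)) → IsLargestBelow w p))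
         × ((Σ CF λ w → InExt w × fExt w ≡ P-R (f (label p)))
          × (∀ w → InExt w → fExt w ≡ P-R (f (label p)) → IsSmallestAbove w p)))
theorem3p1 =
  f-label ,
  (λ pre a b _ _ → eval-last-monotone pre a b) ,
  (injective , (λ s → label s , (s , refl) , f-label s) , (λ p → cong length (sym (f-label p))) ,
   children , order) ,
  parents
  where
  injective : ∀ v v′ → InC v → InC v′ → f v ≡ f v′ → v ≡ v′
  injective _ _ (p , refl) (p′ , refl) fv≡fv′ =
    cong label (trans (sym (f-label p)) (trans fv≡fv′ (f-label p′)))
  children : ∀ v → InC v → f (CL v) ≡ f v ∷ʳ L × f (CR v) ≡ f v ∷ʳ R
  children _ (p , refl) = f-CL (label-positive p) , f-CR (label-positive p)
  order : ∀ v v′ → InC v → InC v′ → (eval v <∞ eval v′ ⇔ r (f v) ℚ.< r (f v′))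
  order _ _ (p , refl) (p′ , refl) rewrite f-label p | f-label p′ = eval<⇔r< p p′
  parents : ∀ p →
    ((Σ CF λ w → InExt w × fExt w ≡ P-L (f (label p)))
     × (∀ w → InExt w → fExt w ≡ P-L (f (label p)) → IsLargestBelow w p))
    × ((Σ CF λ w → InExt w × fExt w ≡ P-R (f (label p)))
     × (∀ w → InExt w → fExt w ≡ P-R (f (label p)) → IsSmallestAbove w p))
  parents p rewrite f-label p =
    fExt-preimage-unique (λ w → IsLargestBelow w p) (left-parent p) ,
    fExt-preimage-unique (λ w → IsSmallestAbove w p) (right-parent p)
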